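{- Let $G$ be a graph, let $b$ be an orientable balanced valuation of $G$, and let $S,T\subseteq V(G)$ with $\partial(S)\neq0$ and $\partial(T)\neq 0$. Suppose that $b(T)=0$ and that, among the edges with exactly one end in $T$, exactly half have their other end in $S$ (and the other half in $V(G)\setminus S$). If $T\subseteq S$, then $\phi(S\setminus T,b)=\phi(S,b)$. If $T\subseteq V(G)\setminus S$, then $\phi(S\cup T,b)=\phi(S,b)$.
   Context: For $S\subseteq V(G)$, $\partial(S)$ denotes the number of edges with exactly one end in $S$, and for $b:V(G)\to\mathbb{Z}$, $b(S)=\sum_{v\in S}b(v)$. A balanced valuation of $G$ is a map $b:V(G)\to\mathbb{Z}$ such that $b(S)\le\partial(S)$ for every $S\subseteq V(G)$ and $b(v)\equiv\partial(\{v\})\pmod 2$ for every vertex $v$. It is orientable if $b(S)<\partial(S)$ for every $S\subseteq V(G)$ with $\partial(S)\ne 0$. For such $S$ define $\phi(S,b)=\frac{\partial(S)+b(S)}{\partial(S)-b(S)}+1$. -}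

module Defs where

open import Data.Bool using (Bool; true; false; if_then_else_; _xor_; _∧_)
open import Data.Nat as ℕ using (ℕ; zero; suc)
open import Data.Integer as ℤ using (ℤ; +_; _-_; _≤_; _<_)
open import Data.Integer.Divisibility using (_∣_)
open import Data.Rational as ℚ using (ℚ; 0ℚ; 1ℚ)
open import Data.Fin using (Fin)
open import Data.Fin.Subset using (Subset; ⁅_⁆)
open import Data.Vec using (lookup)
open import Data.List using (List; allFin; map; foldr; filterᵇ; length)
open import Data.Product using (_×_; _,_)
open import Relation.Nullary using (¬_)
open import Relation.Binary.PropositionalEquality using (_≡_)

-- A finite (multi)graph on the vertex set Fin n; edges are a list of
-- unordered pairs of endpoints (parallel edges and loops allowed).
record Graph : Set where
  field
    n     : ℕ
    edges : List (Fin n × Fin n)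
open Graph public

_∈ᵇ_ : ∀ {n} → Fin n → Subset n → Bool
v ∈ᵇ S = lookup S v

crossesᵇ : ∀ {n} → Subset n → Fin n × Fin n → Bool
crossesᵇ S (u , v) = (u ∈ᵇ S) xor (v ∈ᵇ S)

∂ : (G : Graph) → Subset (n G) → ℕ
∂ G S = length (filterᵇ (crossesᵇ S) (edges G))

otherEnd : ∀ {n} → Subset n → Fin n × Fin n → Fin n
otherEnd T (u , v) = if u ∈ᵇ T then v else u

∂to : (G : Graph) → Subset (n G) → Subset (n G) → ℕ
∂to G T S = length (filterᵇ (λ e → crossesᵇ T e ∧ (otherEnd T e ∈ᵇ S)) (edges G))

bsum : ∀ {n} → (Fin n → ℤ) → Subset n → ℤ
bsum {n} b S = foldr ℤ._+_ (+ 0) (map (λ v → if v ∈ᵇ S then b v else + 0) (allFin n))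

record IsBalanced (G : Graph) (b : Fin (n G) → ℤ) : Set where
  field
    bounded : ∀ (S : Subset (n G)) → bsum b S ≤ + ∂ G S
    parity  : ∀ (v : Fin (n G)) → (+ 2) ∣ (b v - + ∂ G ⁅ v ⁆)

record IsOrientable (G : Graph) (b : Fin (n G) → ℤ) : Set where
  field
    balanced : IsBalanced G b
    strict   : ∀ (S : Subset (n G)) → ¬ (∂ G S ≡ 0) → bsum b S < + ∂ G S

-- ratio p / q in ℚ, totalised to 0 when q = 0 (never used in that case)
ratio : ℤ → ℕ → ℚ
ratio p zero    = 0ℚ
ratio p (suc q) = p ℚ./ suc q

φ : (G : Graph) → (Fin (n G) → ℤ) → Subset (n G) → ℚ
φ G b S = ratio (+ ∂ G S ℤ.+ bsum b S) ℤ.∣ + ∂ G S - bsum b S ∣ ℚ.+ 1ℚ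

{-# OPTIONS --safe #-}
-- An edge leaving T has its far end either in S or outside S, and the hypothesis
-- says both kinds are equally numerous. Removing T from S ⊇ T makes the first kind
-- cross and the second stop crossing; adding T to S disjoint from T does the
-- reverse. So ∂ is unchanged, b(T) = 0 leaves b unchanged, and φ depends only on
-- ∂ and b. Orientability and ∂ ≠ 0 only make φ meaningful.
module Submission where

open import Defs
open import Data.Nat using (ℕ; _*_)
open import Data.Integer using (ℤ; +_)
open import Data.Fin using (Fin)
open import Data.Fin.Subset using (Subset; _⊆_; ∁; _─_; _∪_)
open import Data.Product using (_×_)
open import Relation.Nullary using (¬_)
open import Relation.Binary.PropositionalEquality using (_≡_)

open import Algebra.Properties.CommutativeSemigroup using (interchange)
open import Data.Bool using (Bool; true; false; not; _∧_; _∨_; _xor_; if_then_else_; _≤_; f≤t; b≤b)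
open import Data.Bool.Properties using (≤-minimum; ∧-zeroʳ; ∧-identityʳ; if-float)
open import Data.Fin using (zero; suc)
import Data.Integer as ℤ
import Data.Integer.Properties as ℤ
open import Data.List using (List; []; _∷_; filterᵇ; length; foldr; map; allFin)
import Data.Nat as ℕ
import Data.Nat.Properties as ℕ
open import Data.Product using (_,_)
import Data.Rational as ℚ
open import Data.Vec using (_∷_; lookup)
open import Data.Vec.Properties using (lookup-map; lookup-zipWith; []=⇒lookup; lookup⇒[]=)
open import Relation.Binary.PropositionalEquality using (refl; sym; trans; cong; cong₂; module ≡-Reasoning)

[_] : Bool → ℕ
[ b ] = if b then 1 else 0

length-filterᵇ-∷ : ∀ {A : Set} (p : A → Bool) x xs →
  length (filterᵇ p (x ∷ xs)) ≡ [ p x ] ℕ.+ length (filterᵇ p xs)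
length-filterᵇ-∷ p x xs with p x
... | true  = refl
... | false = refl

length-filterᵇ-+-cong : ∀ {A : Set} (f g h k : A → Bool) →
  (∀ x → [ f x ] ℕ.+ [ g x ] ≡ [ h x ] ℕ.+ [ k x ]) → ∀ xs →
  length (filterᵇ f xs) ℕ.+ length (filterᵇ g xs) ≡ length (filterᵇ h xs) ℕ.+ length (filterᵇ k xs)
length-filterᵇ-+-cong f g h k pointwise []       = refl
length-filterᵇ-+-cong f g h k pointwise (x ∷ xs) = begin
  #f (x ∷ xs) ℕ.+ #g (x ∷ xs)
    ≡⟨ cong₂ ℕ._+_ (length-filterᵇ-∷ f x xs) (length-filterᵇ-∷ g x xs) ⟩
  ([ f x ] ℕ.+ #f xs) ℕ.+ ([ g x ] ℕ.+ #g xs)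
    ≡⟨ interchange ℕ.+-commutativeSemigroup [ f x ] (#f xs) [ g x ] (#g xs) ⟩
  ([ f x ] ℕ.+ [ g x ]) ℕ.+ (#f xs ℕ.+ #g xs)
    ≡⟨ cong₂ ℕ._+_ (pointwise x) (length-filterᵇ-+-cong f g h k pointwise xs) ⟩
  ([ h x ] ℕ.+ [ k x ]) ℕ.+ (#h xs ℕ.+ #k xs)
    ≡⟨ interchange ℕ.+-commutativeSemigroup [ h x ] [ k x ] (#h xs) (#k xs) ⟩
  ([ h x ] ℕ.+ #h xs) ℕ.+ ([ k x ] ℕ.+ #k xs)
    ≡⟨ sym (cong₂ ℕ._+_ (length-filterᵇ-∷ h x xs) (length-filterᵇ-∷ k x xs)) ⟩
  #h (x ∷ xs) ℕ.+ #k (x ∷ xs) ∎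
  where
  open ≡-Reasoning
  #f #g #h #k : List _ → ℕ
  #f ys = length (filterᵇ f ys)
  #g ys = length (filterᵇ g ys)
  #h ys = length (filterᵇ h ys)
  #k ys = length (filterᵇ k ys)

length-filterᵇ-false : ∀ {A : Set} (xs : List A) → length (filterᵇ (λ _ → false) xs) ≡ 0
length-filterᵇ-false []       = refl
length-filterᵇ-false (_ ∷ xs) = length-filterᵇ-false xs

sumℤ : List ℤ → ℤ
sumℤ = foldr ℤ._+_ (+ 0)

sumℤ-map-+ : ∀ {A : Set} (f g h : A → ℤ) → (∀ x → f x ℤ.+ g x ≡ h x) → ∀ xs →
  sumℤ (map f xs) ℤ.+ sumℤ (map g xs) ≡ sumℤ (map h xs)
sumℤ-map-+ f g h pointwise []       = refl
sumℤ-map-+ f g h pointwise (x ∷ xs) =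
  trans (interchange ℤ.+-commutativeSemigroup (f x) (sumℤ (map f xs)) (g x) (sumℤ (map g xs)))
        (cong₂ ℤ._+_ (pointwise x) (sumℤ-map-+ f g h pointwise xs))

lookup-─ : ∀ {m} (p q : Subset m) i → lookup (p ─ q) i ≡ lookup p i ∧ not (lookup q i)
lookup-─ (s ∷ p) (true  ∷ q) zero    = sym (∧-zeroʳ s)
lookup-─ (s ∷ p) (false ∷ q) zero    = sym (∧-identityʳ s)
lookup-─ (_ ∷ p) (_     ∷ q) (suc i) = lookup-─ p q i

lookup-∪ : ∀ {m} (p q : Subset m) i → lookup (p ∪ q) i ≡ lookup p i ∨ lookup q i
lookup-∪ p q i = lookup-zipWith _∨_ i p q

lookup-∁ : ∀ {m} (p : Subset m) i → lookup (∁ p) i ≡ not (lookup p i)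
lookup-∁ p i = lookup-map i not p

⊆⇒lookup-≤ : ∀ {m} {p q : Subset m} → p ⊆ q → ∀ i → lookup p i ≤ lookup q i
⊆⇒lookup-≤ {p = p} {q} p⊆q i with lookup p i in eq
... | false = ≤-minimum (lookup q i)
... | true rewrite []=⇒lookup (p⊆q (lookup⇒[]= i p eq)) = b≤b

⊆∁⇒lookup-≤-not : ∀ {m} {p q : Subset m} → p ⊆ ∁ q → ∀ i → lookup p i ≤ not (lookup q i)
⊆∁⇒lookup-≤-not {q = q} p⊆∁q i rewrite sym (lookup-∁ q i) = ⊆⇒lookup-≤ p⊆∁q i

indicator-split : ∀ c x → [ c ] ℕ.+ [ false ] ≡ [ c ∧ x ] ℕ.+ [ c ∧ not x ]
indicator-split true  true  = refl
indicator-split true  false = refl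
indicator-split false _     = refl

-- su, tu (sv, tv): membership of the ends u (v) of an edge in S and T.
indicator-─ : ∀ su tu sv tv → tu ≤ su → tv ≤ sv →
  [ (su ∧ not tu) xor (sv ∧ not tv) ] ℕ.+ [ (tu xor tv) ∧ not (if tu then sv else su) ]
  ≡ [ su xor sv ] ℕ.+ [ (tu xor tv) ∧ (if tu then sv else su) ]
indicator-─ _     _ _     _ f≤t f≤t = refl
indicator-─ _     _ true  _ f≤t b≤b = refl
indicator-─ _     _ false _ f≤t b≤b = refl
indicator-─ true  _ _     _ b≤b f≤t = refl
indicator-─ false _ _     _ b≤b f≤t = refl
indicator-─ true  _ true  _ b≤b b≤b = refl
indicator-─ true  _ false _ b≤b b≤b = refl
indicator-─ false _ true  _ b≤b b≤b = refl
indicator-─ false _ false _ b≤b b≤b = refl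

indicator-∪ : ∀ su tu sv tv → tu ≤ not su → tv ≤ not sv →
  [ (su ∨ tu) xor (sv ∨ tv) ] ℕ.+ [ (tu xor tv) ∧ (if tu then sv else su) ]
  ≡ [ su xor sv ] ℕ.+ [ (tu xor tv) ∧ not (if tu then sv else su) ]
indicator-∪ true  _ true  _ b≤b b≤b = refl
indicator-∪ true  _ false _ b≤b f≤t = refl
indicator-∪ true  _ false _ b≤b b≤b = refl
indicator-∪ false _ true  _ f≤t b≤b = refl
indicator-∪ false _ true  _ b≤b b≤b = refl
indicator-∪ false _ false _ f≤t f≤t = refl
indicator-∪ false _ false _ f≤t b≤b = refl
indicator-∪ false _ false _ b≤b f≤t = refl
indicator-∪ false _ false _ b≤b b≤b = refl

towardᵇ : ∀ {m} → Subset m → Subset m → Fin m × Fin m → Bool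
towardᵇ T S e = crossesᵇ T e ∧ (otherEnd T e ∈ᵇ S)

module _ (G : Graph) (S T : Subset (n G)) where

  ∂-split : ∂ G T ≡ ∂to G T S ℕ.+ ∂to G T (∁ S)
  ∂-split = begin
    ∂ G T                                                ≡⟨ sym (ℕ.+-identityʳ _) ⟩
    ∂ G T ℕ.+ 0                                          ≡⟨ cong (∂ G T ℕ.+_) (sym (length-filterᵇ-false (edges G))) ⟩
    ∂ G T ℕ.+ length (filterᵇ (λ _ → false) (edges G))  ≡⟨ length-filterᵇ-+-cong _ _ _ _ pointwise (edges G) ⟩
    ∂to G T S ℕ.+ ∂to G T (∁ S)                          ∎
    where
    open ≡-Reasoning
    pointwise : ∀ e → [ crossesᵇ T e ] ℕ.+ [ false ] ≡ [ towardᵇ T S e ] ℕ.+ [ towardᵇ T (∁ S) e ]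
    pointwise e rewrite lookup-∁ S (otherEnd T e) = indicator-split (crossesᵇ T e) (otherEnd T e ∈ᵇ S)

  ∂-─ : T ⊆ S → ∂ G (S ─ T) ℕ.+ ∂to G T (∁ S) ≡ ∂ G S ℕ.+ ∂to G T S
  ∂-─ T⊆S = length-filterᵇ-+-cong _ _ _ _ pointwise (edges G)
    where
    pointwise : ∀ e → [ crossesᵇ (S ─ T) e ] ℕ.+ [ towardᵇ T (∁ S) e ]
                    ≡ [ crossesᵇ S e ] ℕ.+ [ towardᵇ T S e ]
    pointwise (u , v)
      rewrite lookup-─ S T u | lookup-─ S T v | lookup-∁ S (otherEnd T (u , v))
            | if-float (lookup S) (lookup T u) {v} {u}
      = indicator-─ (lookup S u) (lookup T u) (lookup S v) (lookup T v)
                    (⊆⇒lookup-≤ T⊆S u) (⊆⇒lookup-≤ T⊆S v)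

  ∂-∪ : T ⊆ ∁ S → ∂ G (S ∪ T) ℕ.+ ∂to G T S ≡ ∂ G S ℕ.+ ∂to G T (∁ S)
  ∂-∪ T⊆∁S = length-filterᵇ-+-cong _ _ _ _ pointwise (edges G)
    where
    pointwise : ∀ e → [ crossesᵇ (S ∪ T) e ] ℕ.+ [ towardᵇ T S e ]
                    ≡ [ crossesᵇ S e ] ℕ.+ [ towardᵇ T (∁ S) e ]
    pointwise (u , v)
      rewrite lookup-∪ S T u | lookup-∪ S T v | lookup-∁ S (otherEnd T (u , v))
            | if-float (lookup S) (lookup T u) {v} {u}
      = indicator-∪ (lookup S u) (lookup T u) (lookup S v) (lookup T v)
                    (⊆∁⇒lookup-≤-not T⊆∁S u) (⊆∁⇒lookup-≤-not T⊆∁S v)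

restriction-─ : ∀ s t (x : ℤ) → t ≤ s →
  (if s ∧ not t then x else + 0) ℤ.+ (if t then x else + 0) ≡ (if s then x else + 0)
restriction-─ _     _ x f≤t = ℤ.+-identityʳ x
restriction-─ true  _ x b≤b = ℤ.+-identityˡ x
restriction-─ false _ x b≤b = refl

restriction-∪ : ∀ s t (x : ℤ) → t ≤ not s →
  (if s then x else + 0) ℤ.+ (if t then x else + 0) ≡ (if s ∨ t then x else + 0)
restriction-∪ true  _ x b≤b = ℤ.+-identityʳ x
restriction-∪ false _ x f≤t = refl
restriction-∪ false _ x b≤b = ℤ.+-identityˡ x

module _ {m} (b : Fin m → ℤ) (S T : Subset m) where

  restrictedTo : Subset m → Fin m → ℤ
  restrictedTo X v = if v ∈ᵇ X then b v else + 0

  bsum-─ : T ⊆ S → bsum b (S ─ T) ℤ.+ bsum b T ≡ bsum b S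
  bsum-─ T⊆S = sumℤ-map-+ (restrictedTo (S ─ T)) (restrictedTo T) (restrictedTo S) pointwise (allFin m)
    where
    pointwise : ∀ v → restrictedTo (S ─ T) v ℤ.+ restrictedTo T v ≡ restrictedTo S v
    pointwise v rewrite lookup-─ S T v = restriction-─ (lookup S v) (lookup T v) (b v) (⊆⇒lookup-≤ T⊆S v)

  bsum-∪ : T ⊆ ∁ S → bsum b S ℤ.+ bsum b T ≡ bsum b (S ∪ T)
  bsum-∪ T⊆∁S = sumℤ-map-+ (restrictedTo S) (restrictedTo T) (restrictedTo (S ∪ T)) pointwise (allFin m)
    where
    pointwise : ∀ v → restrictedTo S v ℤ.+ restrictedTo T v ≡ restrictedTo (S ∪ T) v
    pointwise v rewrite lookup-∪ S T v = restriction-∪ (lookup S v) (lookup T v) (b v) (⊆∁⇒lookup-≤-not T⊆∁S v)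

φ-cong : ∀ (G : Graph) b (S S′ : Subset (n G)) →
  ∂ G S ≡ ∂ G S′ → bsum b S ≡ bsum b S′ → φ G b S ≡ φ G b S′
φ-cong G b _ _ = cong₂ (λ d β → ratio (+ d ℤ.+ β) ℤ.∣ + d ℤ.- β ∣ ℚ.+ ℚ.1ℚ)

2*m≡m+n⇒m≡n : ∀ {m n} → 2 * m ≡ m ℕ.+ n → m ≡ n
2*m≡m+n⇒m≡n {m} eq = trans (sym (ℕ.+-identityʳ m)) (ℕ.+-cancelˡ-≡ m _ _ eq)

lemma5 : (G : Graph) (b : Fin (n G) → ℤ) → IsOrientable G b →
    (S T : Subset (n G)) → ¬ (∂ G S ≡ 0) → ¬ (∂ G T ≡ 0) →
    bsum b T ≡ + 0 → 2 * ∂to G T S ≡ ∂ G T →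
    ((T ⊆ S → φ G b (S ─ T) ≡ φ G b S) ×
     (T ⊆ ∁ S → φ G b (S ∪ T) ≡ φ G b S))
lemma5 G b _ S T _ _ bT≡0 half = φ-─ , φ-∪
  where
  toward≡away : ∂to G T S ≡ ∂to G T (∁ S)
  toward≡away = 2*m≡m+n⇒m≡n (trans half (∂-split G S T))

  dropT : ∀ x → x ℤ.+ bsum b T ≡ x
  dropT x = trans (cong (λ y → x ℤ.+ y) bT≡0) (ℤ.+-identityʳ x)

  φ-─ : T ⊆ S → φ G b (S ─ T) ≡ φ G b S
  φ-─ T⊆S = φ-cong G b (S ─ T) S
    (ℕ.+-cancelʳ-≡ (∂to G T S) _ _ (trans (cong (∂ G (S ─ T) ℕ.+_) toward≡away) (∂-─ G S T T⊆S)))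
    (trans (sym (dropT _)) (bsum-─ b S T T⊆S))

  φ-∪ : T ⊆ ∁ S → φ G b (S ∪ T) ≡ φ G b S
  φ-∪ T⊆∁S = φ-cong G b (S ∪ T) S
    (ℕ.+-cancelʳ-≡ (∂to G T S) _ _ (trans (∂-∪ G S T T⊆∁S) (cong (∂ G S ℕ.+_) (sym toward≡away))))
    (trans (sym (bsum-∪ b S T T⊆∁S)) (dropT _))
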